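{- Let $G$ be a $p,q,r$-grid of skewed graphs and let $H$ be a horizontal subgraph of $G$ with top and bottom forming sets $U$ and $V$. Then $|\mathbf{TRACES}_H(U)|\ge (q+1)^r$ and $|\mathbf{TRACES}_H(V)|\ge (q+1)^r$.
   Context: For sequences $U=(u_1,\dots,u_q)$, $V=(v_1,\dots,v_q)$, $SKEW(U,V)$ is the graph on $\{u_1,\dots,u_q,v_1,\dots,v_q\}$ with edge set $\{\{u_i,v_j\}: i\le j\}$. Given mutually disjoint sequences $U_1,\dots,U_p$ of $q$ elements each, a $p,q$-path of skewed graphs is the graph on $U_1\cup\dots\cup U_p$ whose edges are exactly those making $G[U_i\cup U_{i+1}]=SKEW(U_i,U_{i+1})$ for $1\le i\le p-1$; $U_1,\dots,U_p$ are its layers. Given $p,q$-paths of skewed graphs $G^1,\dots,G^r$ (vertex-disjoint) with layer sequences $(U^j_1,\dots,U^j_p)$, a $p,q,r$-grid of skewed graphs is obtained from their disjoint union by, for each $i$, connecting the vertices of the concatenated sequence $U^1_i+\dots+U^r_i$ into a path in this order and then subdividing each edge of this path exactly once. The vertices of the $G^j$ are main vertices; the subdivision vertices are auxiliary. The $i$-th layer of the grid is the subdivided path whose main vertices are those of $U^1_i,\dots,U^r_i$; main vertices of each layer are numbered $1,\dots,qr$ in the order of $U^1_i+\dots+U^r_i$, this number being the coordinate. A horizontal subgraph: choose a set $U$ of main vertices containing exactly one vertex of each coordinate, none in the last layer $p$; for each $u\in U$ let $u'$ be the main vertex of the same coordinate in the next layer, and let $V$ be the set of all such $u'$; the horizontal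 subgraph is $H=G[U\cup V]$, with top forming set $U$ and bottom forming set $V$. For a graph $H$ and $X\subseteq V(H)$, $N_H(S)$ is the set of vertices outside $S$ adjacent in $H$ to a vertex of $S$, and $\mathbf{TRACES}_H(X)=\{N_H(S)\cap (V(H)\setminus X): S \text{ an independent subset of } X \text{ in } H\}$. -}

module Defs where

open import Data.Nat using (ℕ; suc; pred; _+_; _*_; _^_; _≤_; _<_; _≡ᵇ_)
open import Data.Fin using (Fin; toℕ; combine)
open import Data.Bool using (Bool; true; false; _∨_)
open import Data.Product using (Σ; _×_; proj₁; _,_)
open import Data.Sum using (_⊎_)
open import Data.Empty using (⊥)
open import Relation.Nullary using (¬_)
open import Relation.Binary.PropositionalEquality using (_≡_)
open import Function.Bundles using (_⇔_)

record Graph : Set₁ where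
  field
    V   : Set
    Adj : V → V → Set
open Graph public

_∈ₛ_ : {A : Set} → A → (A → Bool) → Set
v ∈ₛ S = S v ≡ true

Induced : (G : Graph) → (V G → Bool) → Graph
Induced G W = record { V = Σ (V G) (λ v → W v ≡ true)
                     ; Adj = λ a b → Adj G (proj₁ a) (proj₁ b) }

Independent : (H : Graph) → (V H → Bool) → Set
Independent H S = ∀ a b → a ∈ₛ S → b ∈ₛ S → ¬ Adj H a b

InNbhd : (H : Graph) → (V H → Bool) → V H → Set
InNbhd H S v = ¬ (v ∈ₛ S) × Σ (V H) (λ s → s ∈ₛ S × Adj H s v)

IsTrace : (H : Graph) → (X : V H → Bool) → (V H → Bool) → Set
IsTrace H X T = Σ (V H → Bool) λ S →
  (∀ v → v ∈ₛ S → v ∈ₛ X) × Independent H S ×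
  (∀ v → (v ∈ₛ T) ⇔ (InNbhd H S v × ¬ (v ∈ₛ X)))

TracesAtLeast : (H : Graph) → (V H → Bool) → ℕ → Set
TracesAtLeast H X n = Σ (Fin n → V H → Bool) λ f →
  (∀ i → IsTrace H X (f i)) × (∀ i j → (∀ v → f i v ≡ f j v) → i ≡ j)

-- The p,q,r-grid of skewed graphs (concrete model)
-- main i j k : main vertex of layer i, in path G^j, position k in U^j_i
-- aux i t    : subdivision vertex of layer i between coordinates t and t+1
--              (coordinates counted from 0 here)

data GVtx (p q r : ℕ) : Set where
  main : Fin p → Fin r → Fin q → GVtx p q r
  aux  : Fin p → Fin (pred (r * q)) → GVtx p q r

-- coordinate (0-based) of position k of U^j_i in U^1_i + ... + U^r_i
coord : {q r : ℕ} → Fin r → Fin q → ℕ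
coord j k = toℕ (combine j k)

GAdj : {p q r : ℕ} → GVtx p q r → GVtx p q r → Set
GAdj (main i j k) (main i' j' k') =
  j ≡ j' × ((suc (toℕ i) ≡ toℕ i' × toℕ k ≤ toℕ k')
          ⊎ (suc (toℕ i') ≡ toℕ i × toℕ k' ≤ toℕ k))
GAdj (main i j k) (aux i' t) =
  i ≡ i' × (toℕ t ≡ coord j k ⊎ suc (toℕ t) ≡ coord j k)
GAdj (aux i t) (main i' j k) =
  i ≡ i' × (toℕ t ≡ coord j k ⊎ suc (toℕ t) ≡ coord j k)
GAdj (aux _ _) (aux _ _) = ⊥

Grid : ℕ → ℕ → ℕ → Graph
Grid p q r = record { V = GVtx p q r ; Adj = GAdj }

-- Horizontal subgraphs.  A choice of U is a map lay assigning to every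
-- coordinate (j , k) the layer of its U-vertex, which must not be the last.

ValidLayers : (p q r : ℕ) → (Fin r → Fin q → Fin p) → Set
ValidLayers p q r lay = ∀ j k → suc (toℕ (lay j k)) < p

inTop : {p q r : ℕ} → (Fin r → Fin q → Fin p) → GVtx p q r → Bool
inTop lay (main i j k) = toℕ i ≡ᵇ toℕ (lay j k)
inTop lay (aux _ _)    = false

inBot : {p q r : ℕ} → (Fin r → Fin q → Fin p) → GVtx p q r → Bool
inBot lay (main i j k) = toℕ i ≡ᵇ suc (toℕ (lay j k))
inBot lay (aux _ _)    = false

Horizontal : (p q r : ℕ) → (Fin r → Fin q → Fin p) → Graph
Horizontal p q r lay = Induced (Grid p q r) (λ v → inTop lay v ∨ inBot lay v)

-- A choice of at most one vertex of the forming set X in each path G^j is independent in H: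
-- vertices of different paths are joined only through auxiliary vertices, which H omits, and X meets
-- each coordinate once. This gives (q + 1)^r independent sets. Every vertex of X at coordinate k is
-- joined by a rung to the vertex τ_k of H at coordinate k outside X, all rungs of X pointing the same
-- way (down for U, up for V). If two choices with equal traces pick k ≠ k' in the same path, then τ_k
-- is reached from the vertex at k' and τ_k' from the vertex at k; by the skew adjacency this forces
-- k ≤ k' and k' ≤ k, so the trace determines the choice.
module Submission where

open import Defs
open import Data.Nat using (ℕ; suc; _^_)
open import Data.Fin using (Fin)
open import Data.Product using (_×_; proj₁)

open import Data.Nat as ℕ using (zero; _≤_)
open import Data.Nat.Properties as ℕ using (≤-antisym; ≤-refl; ≡ᵇ⇒≡; ≡⇒≡ᵇ)
open import Data.Fin as Fin using (toℕ; fromℕ<; combine; finToFun; funToFin; zero; suc)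
open import Data.Fin.Properties as Fin using (toℕ-injective; toℕ-fromℕ<; funToFin-finToFin)
open import Data.Bool using (Bool; true; false; _∨_; _∧_; not)
open import Data.Bool.Properties using (∧-conicalˡ; ∧-conicalʳ; not-injective; ¬-not; not-¬; T-≡)
open import Data.Product using (∃-syntax; _,_)
open import Data.Sum using (_⊎_; inj₁; inj₂; swap)
open import Data.Empty using (⊥)
open import Function using (_∘_; case_of_)
open import Function.Bundles using (_⇔_; mk⇔; Equivalence)
open import Relation.Nullary using (¬_; Dec; yes; no; does)
open import Relation.Nullary.Decidable using (_×-dec_; _⊎-dec_; dec-true)
open import Relation.Binary.PropositionalEquality

dec-true⁻¹ : ∀ {A : Set} (a? : Dec A) → does a? ≡ true → A
dec-true⁻¹ (yes a) _ = a

≡ᵇ-true⇔ : ∀ {m n} → (m ℕ.≡ᵇ n) ≡ true ⇔ m ≡ n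
≡ᵇ-true⇔ {m} {n} = mk⇔ (≡ᵇ⇒≡ m n ∘ Equivalence.from T-≡) (Equivalence.to T-≡ ∘ ≡⇒≡ᵇ m n)

∨-trueˡ : ∀ {x y} → x ≡ true → x ∨ y ≡ true
∨-trueˡ refl = refl

∨-trueʳ : ∀ {x y} → y ≡ true → x ∨ y ≡ true
∨-trueʳ {true}  _ = refl
∨-trueʳ {false} e = e

funToFin-cong : ∀ {m n} {f g : Fin m → Fin n} → f ≗ g → funToFin f ≡ funToFin g
funToFin-cong {zero} f≗g = refl
funToFin-cong {suc m} f≗g = cong₂ combine (f≗g zero) (funToFin-cong (f≗g ∘ suc))

finToFun-injective : ∀ {m n} {x y : Fin (m ^ n)} → finToFun {m} {n} x ≗ finToFun y → x ≡ y
finToFun-injective {m} {n} {x} {y} x≗y = begin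
  x                              ≡⟨ funToFin-finToFin {n} {m} x ⟨
  funToFin (finToFun {m} {n} x)  ≡⟨ funToFin-cong x≗y ⟩
  funToFin (finToFun {m} {n} y)  ≡⟨ funToFin-finToFin {n} {m} y ⟩
  y                              ∎
  where open ≡-Reasoning

≡-by-suc-cases : ∀ {n} {a b : Fin (suc n)} →
  (∀ k → a ≡ suc k → b ≡ suc k) → (∀ k → b ≡ suc k → a ≡ suc k) → a ≡ b
≡-by-suc-cases {a = zero}  {zero}  _ _ = refl
≡-by-suc-cases {a = zero}  {suc k} _ b⇒a = case b⇒a k refl of λ ()
≡-by-suc-cases {a = suc k} {b}     a⇒b _ = sym (a⇒b k refl)

-- GAdj (main i j k) (main i' j k') unfolds to j ≡ j × Skew (toℕ i) (toℕ k) (toℕ i') (toℕ k').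
Skew : ℕ → ℕ → ℕ → ℕ → Set
Skew i k i' k' = (suc i ≡ i' × k ≤ k') ⊎ (suc i' ≡ i × k' ≤ k)

skew? : ∀ i k i' k' → Dec (Skew i k i' k')
skew? i k i' k' = ((suc i ℕ.≟ i') ×-dec (k ℕ.≤? k')) ⊎-dec ((suc i' ℕ.≟ i) ×-dec (k' ℕ.≤? k))

skew-sym : ∀ {i k i' k'} → Skew i k i' k' → Skew i' k' i k
skew-sym = swap

skew-irrefl : ∀ {i k k'} → ¬ Skew i k i k'
skew-irrefl (inj₁ (() , _))
skew-irrefl (inj₂ (() , _))

skew-no-crossing : ∀ {i i' k k'} → k ≢ k' → Skew i k (suc i') k' → Skew i' k' (suc i) k → ⊥
skew-no-crossing k≢k' (inj₁ (refl , k≤k')) (inj₁ (_ , k'≤k)) = k≢k' (≤-antisym k≤k' k'≤k)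
skew-no-crossing _ (inj₁ (refl , _)) (inj₂ (() , _))
skew-no-crossing _ (inj₂ (refl , _)) (inj₁ (() , _))
skew-no-crossing _ (inj₂ (refl , _)) (inj₂ (() , _))

module _ {p q r : ℕ} where

  adjacent? : (u v : GVtx p q r) → Dec (GAdj u v)
  adjacent? (main i j k) (main i' j' k') =
    (j Fin.≟ j') ×-dec skew? (toℕ i) (toℕ k) (toℕ i') (toℕ k')
  adjacent? (main i j k) (aux i' t) =
    (i Fin.≟ i') ×-dec ((toℕ t ℕ.≟ coord j k) ⊎-dec (suc (toℕ t) ℕ.≟ coord j k))
  adjacent? (aux i t) (main i' j k) =
    (i Fin.≟ i') ×-dec ((toℕ t ℕ.≟ coord j k) ⊎-dec (suc (toℕ t) ℕ.≟ coord j k))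
  adjacent? (aux _ _) (aux _ _) = no λ ()

  main-irrefl : ∀ {i j k} → ¬ GAdj {p} {q} {r} (main i j k) (main i j k)
  main-irrefl (_ , adj) = skew-irrefl adj

  horizontal : (Fin r → Fin q → Fin p) → GVtx p q r → Bool
  horizontal lay v = inTop lay v ∨ inBot lay v

module RungTraces {p q r : ℕ} (lay : Fin r → Fin q → Fin p) (Y : GVtx p q r → Bool)
  (ℓ ℓ' : Fin r → Fin q → Fin p)
  (Y-main : ∀ {i j k} → main i j k ∈ₛ Y ⇔ i ≡ ℓ j k)
  (σ∈H : ∀ j k → main (ℓ j k) j k ∈ₛ horizontal lay)
  (τ∈H : ∀ j k → main (ℓ' j k) j k ∈ₛ horizontal lay)
  (rung : ∀ j k → GAdj (main (ℓ j k) j k) (main (ℓ' j k) j k))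
  (rungs-uncrossed : ∀ {j k k'} → k ≢ k' →
     GAdj (main (ℓ j k') j k') (main (ℓ' j k) j k) → GAdj (main (ℓ j k) j k) (main (ℓ' j k') j k') → ⊥)
  where
  -- ℓ j k is the layer of Y at coordinate (j , k) and ℓ' j k the other layer of H there.

  H : Graph
  H = Horizontal p q r lay

  X : V H → Bool
  X = Y ∘ proj₁

  σ τ : Fin r → Fin q → GVtx p q r
  σ j k = main (ℓ j k) j k
  τ j k = main (ℓ' j k) j k

  τ∉Y : ∀ j k → Y (τ j k) ≡ false
  τ∉Y j k = ¬-not λ τ∈Y →
    main-irrefl (subst (λ i → GAdj (σ j k) (main i j k)) (Equivalence.to Y-main τ∈Y) (rung j k))

  -- In each path G^j, choose no vertex (zero) or the vertex σ j k (suc k).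
  Choice : Set
  Choice = Fin r → Fin (suc q)

  chosen : Choice → GVtx p q r → Bool
  chosen c (main i j k) = does (c j Fin.≟ suc k) ∧ Y (main i j k)
  chosen c (aux _ _)    = false

  reachedFrom : Fin (suc q) → Fin r → GVtx p q r → Bool
  reachedFrom zero     _ _ = false
  reachedFrom (suc k') j v = does (adjacent? (σ j k') v)

  reached : Choice → GVtx p q r → Bool
  reached c (main i j k) = not (Y (main i j k)) ∧ reachedFrom (c j) j (main i j k)
  reached c (aux _ _)    = false

  chosen⇒ : ∀ c {i j k} → main i j k ∈ₛ chosen c → c j ≡ suc k × i ≡ ℓ j k
  chosen⇒ c {i} {j} {k} e =
      dec-true⁻¹ (c j Fin.≟ suc k) (∧-conicalˡ _ _ e)
    , Equivalence.to Y-main (∧-conicalʳ (does (c j Fin.≟ suc k)) _ e)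

  σ-chosen : ∀ c {j k} → c j ≡ suc k → σ j k ∈ₛ chosen c
  σ-chosen c {j} {k} cj≡k
    rewrite dec-true (c j Fin.≟ suc k) cj≡k = Equivalence.from Y-main refl

  chosen-independent : ∀ c {u v} → u ∈ₛ chosen c → v ∈ₛ chosen c → ¬ GAdj u v
  chosen-independent c {main i j k} {main i' .j k'} u∈ v∈ u~v@(refl , _)
    with chosen⇒ c u∈ | chosen⇒ c v∈
  ... | cj≡k , refl | cj≡k' , refl with Fin.suc-injective (trans (sym cj≡k) cj≡k')
  ... | refl = main-irrefl u~v

  reachedFrom⇔ : ∀ {a j v} → v ∈ₛ reachedFrom a j ⇔ (∃[ k' ] a ≡ suc k' × GAdj (σ j k') v)
  reachedFrom⇔ {zero}   = mk⇔ (λ ()) λ ()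
  reachedFrom⇔ {suc k'} {j} {v} =
    mk⇔ (λ e → k' , refl , dec-true⁻¹ (adjacent? (σ j k') v) e)
        (λ { (_ , refl , adj) → dec-true (adjacent? (σ j k') v) adj })

  reached⇒ : ∀ c {i j k} → main i j k ∈ₛ reached c →
    Y (main i j k) ≡ false × ∃[ k' ] c j ≡ suc k' × GAdj (σ j k') (main i j k)
  reached⇒ c {i} {j} {k} e =
      not-injective (∧-conicalˡ _ _ e)
    , Equivalence.to reachedFrom⇔ (∧-conicalʳ (not (Y (main i j k))) _ e)

  ⇒reached : ∀ c {i j k k'} → Y (main i j k) ≡ false → c j ≡ suc k' →
    GAdj (σ j k') (main i j k) → main i j k ∈ₛ reached c
  ⇒reached c {i} {j} {k} {k'} i∉Y cj≡k' adj
    rewrite i∉Y = Equivalence.from (reachedFrom⇔ {c j}) (k' , cj≡k' , adj)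

  chosen-trace : ∀ c → IsTrace H X (reached c ∘ proj₁)
  chosen-trace c = chosen c ∘ proj₁ , chosen⊆Y , independent , λ v → mk⇔ (to v) (from v)
    where
    chosen⊆Y : ∀ v → v ∈ₛ (chosen c ∘ proj₁) → v ∈ₛ X
    chosen⊆Y (main i j k , _) e = ∧-conicalʳ (does (c j Fin.≟ suc k)) _ e

    independent : Independent H (chosen c ∘ proj₁)
    independent (u , _) (v , _) = chosen-independent c

    to : ∀ v → v ∈ₛ (reached c ∘ proj₁) → InNbhd H (chosen c ∘ proj₁) v × ¬ v ∈ₛ X
    to (main i j k , _) e with reached⇒ c e
    ... | v∉Y , k' , cj≡k' , adj =
        ( not-¬ v∉Y ∘ ∧-conicalʳ (does (c j Fin.≟ suc k)) _
        , (σ j k' , σ∈H j k') , σ-chosen c cj≡k' , adj )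
      , not-¬ v∉Y

    from : ∀ v → InNbhd H (chosen c ∘ proj₁) v × ¬ v ∈ₛ X → v ∈ₛ (reached c ∘ proj₁)
    from (main i j k , _) ((_ , (main i' .j k' , _) , s∈ , adj@(refl , _)) , v∉X)
      with chosen⇒ c s∈
    ... | cj≡k' , refl = ⇒reached c (¬-not v∉X) cj≡k' adj

  τ-reached : ∀ c {j k} → c j ≡ suc k → τ j k ∈ₛ reached c
  τ-reached c {j} {k} cj≡k = ⇒reached c (τ∉Y j k) cj≡k (rung j k)

  SameTraces : Choice → Choice → Set
  SameTraces c c' = ∀ (v : V H) → reached c (proj₁ v) ≡ reached c' (proj₁ v)

  -- If c chooses k and c' chooses k' ≠ k in the same path, each rung τ is reached from the other
  -- choice's σ, which the uncrossed rungs forbid.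
  choice-determined : ∀ {c c' j k} → SameTraces c c' → c j ≡ suc k → c' j ≡ suc k
  choice-determined {c} {c'} {j} {k} same cj≡k
    with reached⇒ c' (trans (sym (same (τ j k , τ∈H j k))) (τ-reached c cj≡k))
  ... | _ , k' , c'j≡k' , σk'~τk with k' Fin.≟ k
  ...   | yes refl = c'j≡k'
  ...   | no k'≢k
    with reached⇒ c (trans (same (τ j k' , τ∈H j k')) (τ-reached c' c'j≡k'))
  ...   | _ , k'' , cj≡k'' , σk''~τk' with Fin.suc-injective (trans (sym cj≡k) cj≡k'')
  ...   | refl = case rungs-uncrossed k'≢k σk''~τk' σk'~τk of λ ()

  choice-injective : ∀ {c c'} → SameTraces c c' → ∀ j → c j ≡ c' j
  choice-injective same j =
    ≡-by-suc-cases (λ _ → choice-determined same) (λ _ → choice-determined (sym ∘ same))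

  traces : TracesAtLeast H X (suc q ^ r)
  traces = (λ x → reached (finToFun x) ∘ proj₁)
         , (λ x → chosen-trace (finToFun x))
         , λ x y same → finToFun-injective (choice-injective same)

module Layers {p q r : ℕ} (lay : Fin r → Fin q → Fin p) (valid : ValidLayers p q r lay) where

  lower : Fin r → Fin q → Fin p
  lower j k = fromℕ< (valid j k)

  toℕ-lower : ∀ j k → toℕ (lower j k) ≡ suc (toℕ (lay j k))
  toℕ-lower j k = toℕ-fromℕ< (valid j k)

  inTop-main : ∀ {i j k} → main i j k ∈ₛ inTop lay ⇔ i ≡ lay j k
  inTop-main = mk⇔ (toℕ-injective ∘ Equivalence.to ≡ᵇ-true⇔) (Equivalence.from ≡ᵇ-true⇔ ∘ cong toℕ)

  inBot-main : ∀ {i j k} → main i j k ∈ₛ inBot lay ⇔ i ≡ lower j k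
  inBot-main {j = j} {k} =
    mk⇔ (λ e → toℕ-injective (trans (Equivalence.to ≡ᵇ-true⇔ e) (sym (toℕ-lower j k))))
        (λ e → Equivalence.from ≡ᵇ-true⇔ (trans (cong toℕ e) (toℕ-lower j k)))

  upper∈H : ∀ j k → main (lay j k) j k ∈ₛ horizontal lay
  upper∈H j k = ∨-trueˡ (Equivalence.from inTop-main refl)

  lower∈H : ∀ j k → main (lower j k) j k ∈ₛ horizontal lay
  lower∈H j k = ∨-trueʳ {inTop lay (main (lower j k) j k)} (Equivalence.from inBot-main refl)

  downward-rung : ∀ j k → GAdj (main (lay j k) j k) (main (lower j k) j k)
  downward-rung j k = refl , inj₁ (sym (toℕ-lower j k) , ≤-refl)

  upward-rung : ∀ j k → GAdj (main (lower j k) j k) (main (lay j k) j k)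
  upward-rung j k = refl , inj₂ (sym (toℕ-lower j k) , ≤-refl)

  downward-rungs-uncrossed : ∀ {j k k'} → k ≢ k' →
    GAdj (main (lay j k') j k') (main (lower j k) j k) → GAdj (main (lay j k) j k) (main (lower j k') j k') → ⊥
  downward-rungs-uncrossed {j} {k} {k'} k≢k' (_ , k'~k) (_ , k~k')
    rewrite toℕ-lower j k | toℕ-lower j k' = skew-no-crossing (k≢k' ∘ toℕ-injective) k~k' k'~k

  upward-rungs-uncrossed : ∀ {j k k'} → k ≢ k' →
    GAdj (main (lower j k') j k') (main (lay j k) j k) → GAdj (main (lower j k) j k) (main (lay j k') j k') → ⊥
  upward-rungs-uncrossed {j} {k} {k'} k≢k' (_ , k'~k) (_ , k~k')
    rewrite toℕ-lower j k | toℕ-lower j k' =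
      skew-no-crossing (k≢k' ∘ toℕ-injective) (skew-sym k'~k) (skew-sym k~k')

lemma2 : (p q r : ℕ) (lay : Fin r → Fin q → Fin p) → ValidLayers p q r lay →
    TracesAtLeast (Horizontal p q r lay) (λ w → inTop lay (proj₁ w)) ((suc q) ^ r)
    × TracesAtLeast (Horizontal p q r lay) (λ w → inBot lay (proj₁ w)) ((suc q) ^ r)
lemma2 p q r lay valid =
    RungTraces.traces lay (inTop lay) lay lower
      inTop-main upper∈H lower∈H downward-rung downward-rungs-uncrossed
  , RungTraces.traces lay (inBot lay) lower lay
      inBot-main lower∈H upper∈H upward-rung upward-rungs-uncrossed
  where open Layers lay valid
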